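{- Let $(G,S,T,k)$ be an instance of \textsc{Disjoint Subset-DFVS Compression} and let $T'$ be a shadowless solution of it. Let $C_1,\dots,C_\ell$ be a topological ordering of the strongly connected components of $G\setminus T'$ (so an edge between components can go from $C_i$ to $C_j$ only if $i\le j$). Then: (1) $C_\ell$ contains a non-empty subset $T_0$ of $T$; (2) no edge of $S$ has both endpoints in $C_\ell$; (3) for each edge $(u,v)\in S$ with $u\in C_\ell$, we have $v\in T'$; (4) if $T'\cap S^+=\emptyset$, then $C_\ell\cap S^-=\emptyset$.
   Context: \textsc{Disjoint Subset-DFVS Compression}: an instance $(G,S,T,k)$ consists of a directed graph $G$, $S\subseteq E(G)$, a positive integer $k$, and $T\subseteq V(G)$ such that $G\setminus T$ has no $S$-closed-walk (closed walk containing an edge of $S$); a solution is a set $T'\subseteq V(G)$ with $|T'|\le k$, $T'\cap T=\emptyset$ and $G\setminus T'$ having no $S$-closed-walk. $S^-=\{u:(u,v)\in S\}$, $S^+=\{v:(u,v)\in S\}$. The solution $T'$ is shadowless if there is no vertex $v\notin T\cup T'$ such that $G\setminus T'$ has no path from $T$ to $v$, and no vertex $v\notin T\cup T'$ such that $G\setminus T'$ has no path from $v$ to $T$. -}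

module Defs where

open import Data.Nat using (ℕ; suc; _≤_; _<_)
open import Data.Bool using (Bool; T)
open import Data.Fin using (Fin; fromℕ) renaming (_≤_ to _≤ᶠ_)
open import Data.Fin.Subset using (Subset; _∈_; _∉_; _⊆_; Nonempty; ∣_∣)
open import Data.Product using (Σ; ∃; _×_; _,_)
open import Data.Empty using (⊥)
open import Relation.Nullary using (¬_)
open import Relation.Binary.PropositionalEquality using (_≡_)

record DiGraph (n : ℕ) : Set where
  field
    edge : Fin n → Fin n → Bool

open DiGraph public

Edge : ∀ {n} → DiGraph n → Fin n → Fin n → Set
Edge G u v = T (edge G u v)

EdgeSet : ℕ → Set
EdgeSet n = Fin n → Fin n → Bool

InS : ∀ {n} → EdgeSet n → Fin n → Fin n → Set
InS S u v = T (S u v)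

EdgeSubset : ∀ {n} → EdgeSet n → DiGraph n → Set
EdgeSubset S G = ∀ u v → InS S u v → Edge G u v

InS⁻ : ∀ {n} → EdgeSet n → Fin n → Set
InS⁻ S u = ∃ λ v → InS S u v

InS⁺ : ∀ {n} → EdgeSet n → Fin n → Set
InS⁺ S v = ∃ λ u → InS S u v

-- Walks from u to v in G ∖ X (all visited vertices lie outside X).
data Walk {n} (G : DiGraph n) (X : Subset n) : Fin n → Fin n → Set where
  []  : ∀ {u} → u ∉ X → Walk G X u u
  _∷_ : ∀ {u v w} → (u ∉ X) × Edge G u v → Walk G X v w → Walk G X u w

data UsesS {n} {G : DiGraph n} {X : Subset n} (S : EdgeSet n)
     : ∀ {u w} → Walk G X u w → Set where
  here  : ∀ {u v w} {e : (u ∉ X) × Edge G u v} {p : Walk G X v w} →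
          InS S u v → UsesS S (e ∷ p)
  there : ∀ {u v w} {e : (u ∉ X) × Edge G u v} {p : Walk G X v w} →
          UsesS S p → UsesS S (e ∷ p)

HasSClosedWalk : ∀ {n} → DiGraph n → EdgeSet n → Subset n → Set
HasSClosedWalk G S X = ∃ λ u → Σ (Walk G X u u) λ p → UsesS S p

Reach : ∀ {n} → DiGraph n → Subset n → Fin n → Fin n → Set
Reach G X u v = Walk G X u v

Disjoint : ∀ {n} → Subset n → Subset n → Set
Disjoint A B = ∀ v → v ∈ A → v ∉ B

IsInstance : ∀ {n} → DiGraph n → EdgeSet n → Subset n → ℕ → Set
IsInstance G S T k = EdgeSubset S G × (1 ≤ k) × ¬ HasSClosedWalk G S T

IsSolution : ∀ {n} → DiGraph n → EdgeSet n → Subset n → ℕ → Subset n → Set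
IsSolution G S T k T' = (∣ T' ∣ ≤ k) × Disjoint T' T × ¬ HasSClosedWalk G S T'

IsShadowless : ∀ {n} → DiGraph n → Subset n → Subset n → Set
IsShadowless G T T' =
  (¬ (∃ λ v → v ∉ T × v ∉ T' × ¬ (∃ λ t → t ∈ T × Reach G T' t v))) ×
  (¬ (∃ λ v → v ∉ T × v ∉ T' × ¬ (∃ λ t → t ∈ T × Reach G T' v t)))

IsSCC : ∀ {n} → DiGraph n → Subset n → Subset n → Set
IsSCC G X C =
  Nonempty C ×
  (∀ u → u ∈ C → u ∉ X) ×
  (∀ u v → u ∈ C → v ∈ C → Reach G X u v) ×
  (∀ u v → u ∈ C → v ∉ X → Reach G X u v → Reach G X v u → v ∈ C)

IsTopoOrderedSCCs : ∀ {n ℓ} → DiGraph n → Subset n → (Fin ℓ → Subset n) → Set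
IsTopoOrderedSCCs {n} {ℓ} G X C =
  (∀ i → IsSCC G X (C i)) ×
  (∀ i j → C i ≡ C j → i ≡ j) ×
  (∀ D → IsSCC G X D → ∃ λ i → C i ≡ D) ×
  (∀ i j u v → u ∈ C i → v ∈ C j → Edge G u v → i ≤ᶠ j)

module Submission where

-- The whole lemma rests on
-- one observation: the last component L = C_ℓ is closed under walks of
-- G ∖ T', because an edge leaving L would reach a component with a larger
-- index.  Then
--   (2) an S-edge inside an SCC closes into an S-closed-walk, which the
--       solution T' forbids;
--   (3) an S-edge leaving L cannot stay in G ∖ T' (it would stay in L, and
--       contradict (2)), so its head lies in T';
--   (4) follows from (3) at once;
--   (1) a vertex of L outside T reaches T (shadowlessness), and by closure
--       that vertex of T lies in L.
-- Constructively, "every vertex of G ∖ T' lies in some Cᵢ" needs the SCC of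
-- the vertex as a subset, i.e. decidable mutual reachability.  We only get
-- this under a double negation, which is harmless because every conclusion
-- drawn from it (membership in a finite subset) is decidable.

open import Defs
open import Data.Nat using (ℕ; suc)
open import Data.Bool.Properties using (T-≡)
open import Data.Fin using (Fin; fromℕ)
open import Data.Fin.Subset using (Subset; _∈_; _∉_; _⊆_; Nonempty; _∩_)
open import Data.Fin.Subset.Properties using (_∈?_; nonempty?; p∩q⊆p; p∩q⊆q; x∈p∩q⁺)
import Data.Fin.Properties as Fin
open import Data.Product using (Σ; ∃; _×_; _,_; proj₁; proj₂)
open import Data.Vec using (tabulate)
open import Data.Vec.Properties using (lookup∘tabulate; []=⇒lookup; lookup⇒[]=)
open import Effect.Monad using (RawMonad)
open import Function.Bundles using (Equivalence)
open import Level using (0ℓ)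
open import Relation.Nullary using (¬_; yes; no)
open import Relation.Nullary.Decidable using (isYes; toWitness; fromWitness; decidable-stable; ¬¬-excluded-middle)
open import Relation.Nullary.Negation using (¬¬-Monad; ¬¬-map)
open import Relation.Unary using (Pred; Decidable)
open import Relation.Binary.PropositionalEquality using (_≡_; sym; trans; subst)

module _ {n} {G : DiGraph n} {X : Subset n} where

  walk-source : ∀ {u v} → Walk G X u v → u ∉ X
  walk-source ([] u∉X)       = u∉X
  walk-source ((u∉X , _) ∷ _) = u∉X

  _++ʷ_ : ∀ {u v w} → Walk G X u v → Walk G X v w → Walk G X u w
  [] _     ++ʷ q = q
  (e ∷ p) ++ʷ q = e ∷ (p ++ʷ q)

module _ {n} {P : Pred (Fin n) 0ℓ} (P? : Decidable P) where

  fromDec : Subset n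
  fromDec = tabulate (λ x → isYes (P? x))

  ∈-fromDec⁺ : ∀ {x} → P x → x ∈ fromDec
  ∈-fromDec⁺ {x} p = lookup⇒[]= x fromDec
    (trans (lookup∘tabulate _ x) (Equivalence.to T-≡ (fromWitness p)))

  ∈-fromDec⁻ : ∀ {x} → x ∈ fromDec → P x
  ∈-fromDec⁻ {x} x∈ = toWitness {a? = P? x}
    (Equivalence.from T-≡ (trans (sym (lookup∘tabulate _ x)) ([]=⇒lookup x∈)))

-- Any predicate on a finite type is decidable, up to double negation:
-- excluded middle holds ¬¬-pointwise, and ¬¬ commutes with finite products.
¬¬-decidable : ∀ {n} (P : Pred (Fin n) 0ℓ) → ¬ ¬ Decidable P
¬¬-decidable P = Fin.sequence (RawMonad.rawApplicative ¬¬-Monad) (λ _ → ¬¬-excluded-middle)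

Mutual : ∀ {n} → DiGraph n → Subset n → Fin n → Fin n → Set
Mutual G X u v = Reach G X u v × Reach G X v u

sccOf-isSCC : ∀ {n} {G : DiGraph n} {X : Subset n} {w} → w ∉ X →
              (mutual? : Decidable (Mutual G X w)) → IsSCC G X (fromDec mutual?)
sccOf-isSCC {w = w} w∉X mutual? =
  (w , ∈-fromDec⁺ mutual? ([] w∉X , [] w∉X)) ,
  (λ u u∈ → walk-source (proj₂ (∈-fromDec⁻ mutual? u∈))) ,
  (λ u v u∈ v∈ → proj₂ (∈-fromDec⁻ mutual? u∈) ++ʷ proj₁ (∈-fromDec⁻ mutual? v∈)) ,
  (λ u v u∈ _ u→v v→u →
     let (w→u , u→w) = ∈-fromDec⁻ mutual? u∈
     in ∈-fromDec⁺ mutual? (w→u ++ʷ u→v , v→u ++ʷ u→w))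

covered : ∀ {n ℓ} {G : DiGraph n} {X : Subset n} {C : Fin ℓ → Subset n} →
          (∀ D → IsSCC G X D → ∃ λ i → C i ≡ D) →
          ∀ {w} → w ∉ X → ¬ ¬ (∃ λ i → w ∈ C i)
covered {G = G} {X} {C} complete {w} w∉X = ¬¬-map inOwnSCC (¬¬-decidable (Mutual G X w))
  where
  inOwnSCC : Decidable (Mutual G X w) → ∃ λ i → w ∈ C i
  inOwnSCC mutual? =
    let (i , Cᵢ≡D) = complete (fromDec mutual?) (sccOf-isSCC w∉X mutual?)
    in i , subst (w ∈_) (sym Cᵢ≡D) (∈-fromDec⁺ mutual? ([] w∉X , [] w∉X))

walk-closed : ∀ {n} {G : DiGraph n} {X A : Subset n} →
              (∀ u v → u ∈ A → v ∉ X → Edge G u v → v ∈ A) →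
              ∀ {u v} → u ∈ A → Walk G X u v → v ∈ A
walk-closed step u∈A ([] _)        = u∈A
walk-closed step u∈A ((_ , e) ∷ p) = walk-closed step (step _ _ u∈A (walk-source p) e) p

-- In G ∖ X without S-closed-walks, no S-edge has both ends in one SCC:
-- the edge followed by a walk back would be an S-closed-walk.
no-internal-S-edge : ∀ {n} {G : DiGraph n} {S : EdgeSet n} {X D : Subset n} →
                     EdgeSubset S G → ¬ HasSClosedWalk G S X → IsSCC G X D →
                     ∀ u v → InS S u v → u ∈ D → v ∉ D
no-internal-S-edge S⊆E acyclic (_ , outside , strong , _) u v s u∈D v∈D =
  acyclic (u , (outside u u∈D , S⊆E u v s) ∷ strong v u v∈D u∈D , here s)

-- Every vertex of G ∖ X outside T reaches T in G ∖ X
-- (the second half of shadowlessness).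
ReachesT : ∀ {n} → DiGraph n → Subset n → Subset n → Set
ReachesT G T X = ¬ (∃ λ v → v ∉ T × v ∉ X × ¬ (∃ λ t → t ∈ T × Reach G X v t))

module LastComponent {n m} {G : DiGraph n} {X : Subset n} {C : Fin (suc m) → Subset n}
                     (topo : IsTopoOrderedSCCs G X C) where

  L : Subset n
  L = C (fromℕ m)

  L-isSCC : IsSCC G X L
  L-isSCC = proj₁ topo (fromℕ m)

  -- An edge of G ∖ X leaving L would enter a component of larger index.
  edge-closed : ∀ u v → u ∈ L → v ∉ X → Edge G u v → v ∈ L
  edge-closed u v u∈L v∉X e = decidable-stable (v ∈? L)
    (¬¬-map inLast (covered (proj₁ (proj₂ (proj₂ topo))) v∉X))
    where
    inLast : ∃ (λ i → v ∈ C i) → v ∈ L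
    inLast (i , v∈Cᵢ) = subst (λ j → v ∈ C j) i≡last v∈Cᵢ
      where
      i≡last : i ≡ fromℕ m
      i≡last = Fin.≤-antisym (Fin.≤fromℕ i) (proj₂ (proj₂ (proj₂ topo)) (fromℕ m) i u v u∈L v∈Cᵢ e)

  closed : ∀ {u v} → u ∈ L → Walk G X u v → v ∈ L
  closed = walk-closed edge-closed

  -- An S-edge leaving L ends in X: otherwise, by closure, it would be an
  -- S-edge inside L.
  S-edge-into-X : ∀ {S : EdgeSet n} → EdgeSubset S G → ¬ HasSClosedWalk G S X →
                  ∀ u v → InS S u v → u ∈ L → v ∈ X
  S-edge-into-X S⊆E acyclic u v s u∈L = decidable-stable (v ∈? X) λ v∉X →
    no-internal-S-edge S⊆E acyclic L-isSCC u v s u∈L (edge-closed u v u∈L v∉X (S⊆E u v s))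

  -- If every vertex of G ∖ X reaches T, then L meets T: a vertex of L is in
  -- T, or reaches a vertex of T that by closure is again in L.
  meets : ∀ {T : Subset n} → ReachesT G T X → Nonempty (T ∩ L)
  meets {T} reaches with proj₁ L-isSCC
  ... | v , v∈L with v ∈? T
  ...   | yes v∈T = v , x∈p∩q⁺ (v∈T , v∈L)
  ...   | no  v∉T = decidable-stable (nonempty? (T ∩ L)) λ T∩L-empty →
            reaches (v , v∉T , proj₁ (proj₂ L-isSCC) v v∈L ,
                     λ (t , t∈T , v→t) → T∩L-empty (t , x∈p∩q⁺ (t∈T , closed v∈L v→t)))

lemma15 : ∀ {n} (G : DiGraph n) (S : EdgeSet n) (T : Subset n) (k : ℕ) (T' : Subset n) →
          IsInstance G S T k → IsSolution G S T k T' → IsShadowless G T T' →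
          ∀ (m : ℕ) (C : Fin (suc m) → Subset n) → IsTopoOrderedSCCs G T' C →
          (Σ (Subset n) λ T₀ → Nonempty T₀ × T₀ ⊆ T × T₀ ⊆ C (fromℕ m)) ×
          (∀ u v → InS S u v → u ∈ C (fromℕ m) → ¬ (v ∈ C (fromℕ m))) ×
          (∀ u v → InS S u v → u ∈ C (fromℕ m) → v ∈ T') ×
          ((∀ v → v ∈ T' → ¬ InS⁺ S v) → ∀ u → u ∈ C (fromℕ m) → ¬ InS⁻ S u)
lemma15 G S T k T' (S⊆E , _ , _) (_ , _ , acyclic) (_ , reaches) m C topo =
  (T ∩ L , meets reaches , p∩q⊆p T L , p∩q⊆q T L) ,
  no-internal-S-edge S⊆E acyclic L-isSCC ,
  head-in-T' ,
  λ noS⁺ u u∈L (v , s) → noS⁺ v (head-in-T' u v s u∈L) (u , s)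
  where
  open LastComponent topo
  head-in-T' : ∀ u v → InS S u v → u ∈ L → v ∈ T'
  head-in-T' = S-edge-into-X S⊆E acyclic
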